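{- Let $n\ge2$, $S_1,S_2\subseteq[n]$, and let $F$ be a subspace belonging to both $\mathcal L(\mathcal D_{n,S_1})$ and $\mathcal L(\mathcal D_{n,S_2})$ such that $F\not\subseteq H_j$ for every $j\in (S_1\setminus S_2)\cup(S_2\setminus S_1)$. Then the intervals $[\mathbb R^n,F]$ in $\mathcal L(\mathcal D_{n,S_1})$ and in $\mathcal L(\mathcal D_{n,S_2})$ are isomorphic.
   Context: For $S\subseteq[n]$, $\mathcal D_{n,S}$ is the arrangement in $\mathbb R^n$ consisting of the hyperplanes $\{x_k\pm x_l=0\}$ ($1\le k<l\le n$) and $H_k=\{x_k=0\}$ for $k\in S$. The intersection lattice $\mathcal L(\mathcal A)$ is the set of all intersections of subsets of $\mathcal A$ (including $\mathbb R^n$, the bottom element), ordered by reverse inclusion; $[\mathbb R^n,F]$ is the set of its elements $X$ with $F\subseteq X$.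
   Formalization: The arrangements $\mathcal D_{n,S}$ and their intersection lattices are taken in ℚ^n rather than in $\mathbb R^n$. -}

module Defs where

open import Data.Nat using (ℕ)
open import Data.Fin using (Fin; _<_)
open import Data.Fin.Subset using (Subset; _∈_; _∉_)
open import Data.Rational using (ℚ; 0ℚ; _+_; _-_)
open import Data.List using (List)
open import Data.List.Relation.Unary.All using (All)
open import Data.Product using (Σ; _×_; ∃; proj₁)
open import Data.Sum using (_⊎_)
open import Relation.Binary.PropositionalEquality using (_≡_)
open import Relation.Nullary using (¬_)
open import Level using (Level)

Point : ℕ → Set
Point n = Fin n → ℚ

Subspace : ℕ → Set₁
Subspace n = Point n → Set

_⊆ₛ_ : ∀ {n} → Subspace n → Subspace n → Set
X ⊆ₛ Y = ∀ x → X x → Y x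

_≈ₛ_ : ∀ {n} → Subspace n → Subspace n → Set
X ≈ₛ Y = (X ⊆ₛ Y) × (Y ⊆ₛ X)

data Hyp (n : ℕ) : Set where
  plus  : Fin n → Fin n → Hyp n
  minus : Fin n → Fin n → Hyp n
  coord : Fin n → Hyp n

hypSet : ∀ {n} → Hyp n → Subspace n
hypSet (plus k l)  x = x k + x l ≡ 0ℚ
hypSet (minus k l) x = x k - x l ≡ 0ℚ
hypSet (coord k)   x = x k ≡ 0ℚ

H : ∀ {n} → Fin n → Subspace n
H k = hypSet (coord k)

InD : ∀ {n} → Subset n → Hyp n → Set
InD S (plus k l)  = k < l
InD S (minus k l) = k < l
InD S (coord k)   = k ∈ S

⋂ : ∀ {n} → List (Hyp n) → Subspace n
⋂ hs x = All (λ h → hypSet h x) hs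

InL : ∀ {n} → Subset n → Subspace n → Set
InL {n} S X = Σ (List (Hyp n)) λ hs → All (InD S) hs × (X ≈ₛ ⋂ hs)

Interval : ∀ {n} → Subset n → Subspace n → Set₁
Interval {n} S F = Σ (Subspace n) λ X → InL S X × (F ⊆ₛ X)

elt : ∀ {n} {S : Subset n} {F : Subspace n} → Interval S F → Subspace n
elt = proj₁

_≤L_ : ∀ {n} → Subspace n → Subspace n → Set
X ≤L Y = Y ⊆ₛ X

-- Isomorphism of the two interval posets (elements identified up to
-- equality of subspaces): mutually inverse maps that preserve and reflect order.
record IntervalIso {n} (S₁ S₂ : Subset n) (F : Subspace n) : Set₁ where
  field
    to   : Interval S₁ F → Interval S₂ F
    from : Interval S₂ F → Interval S₁ F
    from∘to : ∀ X → elt (from (to X)) ≈ₛ elt X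
    to∘from : ∀ Y → elt (to (from Y)) ≈ₛ elt Y
    to-mono   : ∀ X Y → elt X ≤L elt Y → elt (to X) ≤L elt (to Y)
    from-mono : ∀ X Y → elt X ≤L elt Y → elt (from X) ≤L elt (from Y)

module Submission where

-- Every element X of [ℝⁿ, F] contains F, so every hyperplane in a presentation of X
-- contains F.  A coordinate hyperplane H_j containing F has j in both S₁ and S₂ or in
-- neither, so the same presentation exhibits X in the other lattice: the isomorphism
-- is the identity on subspaces.

open import Defs
open import Data.Nat using (ℕ; _≤_)
open import Data.Fin using (Fin)
open import Data.Fin.Subset using (Subset; _∈_; _∉_)
open import Data.Fin.Subset.Properties using (_∈?_)
open import Data.Product using (_×_; _,_; proj₁)
open import Data.Sum using (_⊎_; inj₁; inj₂)
open import Data.Empty using (⊥-elim)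
open import Data.List using (List; []; _∷_)
open import Data.List.Relation.Unary.All using (All; []; _∷_; head; tail)
open import Relation.Nullary using (¬_; yes; no)

module _ {n : ℕ} {S₁ S₂ : Subset n} {F : Subspace n}
         (F⊈H : (j : Fin n) → j ∈ S₁ → j ∉ S₂ → ¬ (F ⊆ₛ H j)) where

  InD-transfer : (h : Hyp n) → F ⊆ₛ hypSet h → InD S₁ h → InD S₂ h
  InD-transfer (plus k l)  _   k<l = k<l
  InD-transfer (minus k l) _   k<l = k<l
  InD-transfer (coord j)   F⊆H j∈S₁ with j ∈? S₂
  ... | yes j∈S₂ = j∈S₂
  ... | no  j∉S₂ = ⊥-elim (F⊈H j j∈S₁ j∉S₂ F⊆H)

  All-InD-transfer : (hs : List (Hyp n)) → F ⊆ₛ ⋂ hs → All (InD S₁) hs → All (InD S₂) hs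
  All-InD-transfer []       _    []       = []
  All-InD-transfer (h ∷ hs) F⊆hs (p ∷ ps) =
    InD-transfer h (λ x Fx → head (F⊆hs x Fx)) p
      ∷ All-InD-transfer hs (λ x Fx → tail (F⊆hs x Fx)) ps

  Interval-transfer : Interval S₁ F → Interval S₂ F
  Interval-transfer (X , (hs , hs∈D , X≈hs) , F⊆X) =
    X , (hs , All-InD-transfer hs (λ x Fx → proj₁ X≈hs x (F⊆X x Fx)) hs∈D , X≈hs) , F⊆X

lemma4p37 : (n : ℕ) → 2 ≤ n → (S₁ S₂ : Subset n) (F : Subspace n) →
    InL S₁ F → InL S₂ F →
    ((j : Fin n) → ((j ∈ S₁ × j ∉ S₂) ⊎ (j ∈ S₂ × j ∉ S₁)) → ¬ (F ⊆ₛ H j)) →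
    IntervalIso S₁ S₂ F
lemma4p37 n _ S₁ S₂ F _ _ F⊈H = record
  { to        = Interval-transfer (λ j j∈S₁ j∉S₂ → F⊈H j (inj₁ (j∈S₁ , j∉S₂)))
  ; from      = Interval-transfer (λ j j∈S₂ j∉S₁ → F⊈H j (inj₂ (j∈S₂ , j∉S₁)))
  ; from∘to   = λ _ → ≈ₛ-refl
  ; to∘from   = λ _ → ≈ₛ-refl
  ; to-mono   = λ _ _ X≤Y → X≤Y
  ; from-mono = λ _ _ X≤Y → X≤Y
  }
  where
  ≈ₛ-refl : {X : Subspace n} → X ≈ₛ X
  ≈ₛ-refl = (λ _ x∈X → x∈X) , (λ _ x∈X → x∈X)
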